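{- For any $\phi\in \mathrm{PL}(\mathrm{NE})$, $\phi$ and $\neg \phi$ are ground-complementary modulo $\bot\wedge\mathrm{NE}$: either $|\phi|_\mathsf{X}=|\top|_\mathsf{X}\setminus|\neg\phi|_\mathsf{X}$ and $|\neg\phi|_\mathsf{X}=|\top|_\mathsf{X}\setminus|\phi|_\mathsf{X}$ for all $\mathsf{X}\supseteq\mathsf{P}(\phi)$, or $\phi\equiv\bot\wedge\mathrm{NE}$, or $\neg\phi\equiv\bot\wedge\mathrm{NE}$.
   Context: $\mathrm{PL}(\mathrm{NE})$: $\phi ::= p \mid \bot \mid \neg\phi \mid \phi\wedge\phi \mid \phi\vee\phi \mid \mathrm{NE}$, on propositional teams with support $\models$ / anti-support $\models^-$: $p$ supported iff all $w\in s$ make $p$ true, anti-supported iff none do; $s\models\bot$ iff $s=\emptyset$, $\bot$ always anti-supported; $s\models\mathrm{NE}$ iff $s\ne\emptyset$, $s\models^-\mathrm{NE}$ iff $s=\emptyset$; $\neg$ swaps support and anti-support; $\wedge$ supported iff both conjuncts are, anti-supported iff $s=t\cup u$ with $t\models^-\phi,u\models^-\psi$; $\vee$ supported iff $s=t\cup u$ with $t\models\phi,u\models\psi$, anti-supported iff both are. $\top:=\neg\bot$. The ground team $|\phi|_\mathsf{X}$ is the set of valuations over $\mathsf{X}$ belonging to some team over $\mathsf{X}$ supporting $\phi$; $|\top|_\mathsf{X}=2^\mathsf{X}$. $\bot\wedge\mathrm{NE}$ is supported by no team. -}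

module Defs where

open import Data.Nat using (ℕ; _≡ᵇ_)
open import Data.Bool using (Bool; true; false; _∨_; if_then_else_)
open import Data.List using (List; []; _∷_; _++_; length)
open import Data.List.Membership.Propositional using (_∈_)
open import Data.List.Relation.Unary.All using (All)
open import Data.List.Relation.Unary.Unique.Propositional using (Unique)
open import Data.Vec using (Vec; []; _∷_)
open import Data.Product using (Σ; _×_; ∃; ∃-syntax)
open import Relation.Binary.PropositionalEquality using (_≡_)
open import Function.Bundles using (_⇔_)
open import Data.Unit using (⊤)
open import Data.Empty using (⊥)
open import Relation.Nullary using (¬_)

data Form : Set where
  var : ℕ → Form
  ⊥f  : Form
  ¬f_ : Form → Form
  _∧f_ : Form → Form → Form
  _∨f_ : Form → Form → Form
  NE  : Form

⊤f : Form
⊤f = ¬f ⊥f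

vars : Form → List ℕ
vars (var p) = p ∷ []
vars ⊥f = []
vars (¬f φ) = vars φ
vars (φ ∧f ψ) = vars φ ++ vars ψ
vars (φ ∨f ψ) = vars φ ++ vars ψ
vars NE = []

-- A finite set X of propositional variables is a duplicate-free list.
-- A valuation over X assigns a truth value to each element of X (in order).
Val : List ℕ → Set
Val X = Vec Bool (length X)

-- value of variable p under valuation w over X (false if p ∉ X; never used then)
val : (X : List ℕ) → Val X → ℕ → Bool
val [] [] p = false
val (x ∷ X) (b ∷ w) p = if x ≡ᵇ p then b else val X w p

Team : List ℕ → Set
Team X = Val X → Bool

_∈t_ : {X : List ℕ} → Val X → Team X → Set
w ∈t s = s w ≡ true

Empty : (X : List ℕ) → Team X → Set
Empty X s = (w : Val X) → s w ≡ false

NonEmpty : (X : List ℕ) → Team X → Set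
NonEmpty X s = ∃[ w ] (_∈t_ {X} w s)

IsUnion : (X : List ℕ) → Team X → Team X → Team X → Set
IsUnion X s t u = (w : Val X) → s w ≡ (t w ∨ u w)

syntax sat X s φ = s ⊨[ X ] φ
syntax asat X s φ = s ⊨⁻[ X ] φ

mutual
  sat : (X : List ℕ) → Team X → Form → Set
  s ⊨[ X ] var p = (w : Val X) → _∈t_ {X} w s → val X w p ≡ true
  s ⊨[ X ] ⊥f = Empty X s
  s ⊨[ X ] (¬f φ) = s ⊨⁻[ X ] φ
  s ⊨[ X ] (φ ∧f ψ) = (s ⊨[ X ] φ) × (s ⊨[ X ] ψ)
  s ⊨[ X ] (φ ∨f ψ) = Σ (Team X) (λ t → Σ (Team X) (λ u →
                         IsUnion X s t u × (t ⊨[ X ] φ) × (u ⊨[ X ] ψ)))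
  s ⊨[ X ] NE = NonEmpty X s

  asat : (X : List ℕ) → Team X → Form → Set
  s ⊨⁻[ X ] var p = (w : Val X) → _∈t_ {X} w s → val X w p ≡ false
  s ⊨⁻[ X ] ⊥f = ⊤
  s ⊨⁻[ X ] (¬f φ) = s ⊨[ X ] φ
  s ⊨⁻[ X ] (φ ∧f ψ) = Σ (Team X) (λ t → Σ (Team X) (λ u →
                          IsUnion X s t u × (t ⊨⁻[ X ] φ) × (u ⊨⁻[ X ] ψ)))
  s ⊨⁻[ X ] (φ ∨f ψ) = (s ⊨⁻[ X ] φ) × (s ⊨⁻[ X ] ψ)
  s ⊨⁻[ X ] NE = Empty X s

Over : List ℕ → Form → Set
Over X φ = Unique X × All (_∈ X) (vars φ)

Ground : (X : List ℕ) → Form → Val X → Set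
Ground X φ w = Σ (Team X) (λ s → (s ⊨[ X ] φ) × (_∈t_ {X} w s))

GroundDiff : (X : List ℕ) → Form → Form → Set
GroundDiff X φ ψ = (w : Val X) → Ground X φ w ⇔ (Ground X ⊤f w × ¬ Ground X ψ w)

_≡f_ : Form → Form → Set
φ ≡f ψ = (X : List ℕ) → Over X φ → Over X ψ → (s : Team X) → (s ⊨[ X ] φ) ⇔ (s ⊨[ X ] ψ)

{-# OPTIONS --safe #-}

-- Let ⟦ φ ⟧ be the classical truth value of the flattening of φ (NE read as ⊤). By a
-- simultaneous induction, a team supports φ iff ⟦ φ ⟧ is true throughout it and each of
-- finitely many demands r of φ (NE demands ⊤; a demand of one conjunct is strengthened by the
-- other conjunct) is true at some valuation in it; anti-support is dual, with ⟦ φ ⟧ false.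
-- Every demand classically forces φ, so if all demands are satisfiable, the team of all
-- classical models of φ supports φ and |φ|_X is exactly that team; if one is not, no team
-- supports φ, i.e. φ ≡ ⊥ ∧ NE. Satisfiability of a demand depends only on its variables, so
-- it is the same for every X ⊇ P(φ) and decidable; applying all this to φ and ¬φ gives the
-- three cases.

module Submission where

open import Defs
open import Data.Bool using (Bool; true; false; not; _∧_; _∨_)
open import Data.Bool.Properties
  using (∧-conicalˡ; ∧-conicalʳ; ∨-conicalˡ; ∨-conicalʳ; ∨-zeroʳ; ∧-zeroʳ; not-¬; ¬-not; T-≡)
  renaming (_≟_ to _≟ᵇ_)
open import Data.Empty using (⊥-elim)
open import Data.Fin.Subset.Properties using (anySubset?)
open import Data.List using (List; []; _∷_; _++_; map)
open import Data.List.Membership.Propositional using (_∈_)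
open import Data.List.Membership.Propositional.Properties using (∈-++⁺ˡ; ∈-++⁺ʳ)
open import Data.List.Relation.Binary.Subset.Propositional using (_⊆_)
open import Data.List.Relation.Binary.Subset.Propositional.Properties as ⊆
  using (⊆-trans; xs⊆xs++ys; xs⊆ys++xs)
open import Data.List.Relation.Unary.All as All using (All; []; _∷_; all?)
open import Data.List.Relation.Unary.All.Properties using (gmap⁺; gmap⁻; ++⁺; ++⁻)
open import Data.List.Relation.Unary.Any using (here; there)
open import Data.Nat using (ℕ; _≡ᵇ_)
open import Data.Nat.Properties using (≡ᵇ⇒≡; ≡⇒≡ᵇ)
open import Data.Product using (_×_; _,_; proj₁; proj₂; map₁; swap; ∃-syntax)
open import Data.Sum as Sum using (_⊎_; inj₁; inj₂; [_,_]′)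
open import Data.Unit using (tt)
open import Data.Vec using ([]; _∷_)
open import Function using (_∘_; id)
open import Function.Bundles using (_⇔_; mk⇔; Equivalence)
open import Relation.Nullary using (¬_; Dec; yes; no; contradiction)
open import Relation.Binary.PropositionalEquality using (_≡_; refl; sym; trans; cong; cong₂)

open Equivalence using (to; from)

∨-trueʳ : ∀ a {b} → b ≡ true → a ∨ b ≡ true
∨-trueʳ a refl = ∨-zeroʳ a

∧-falseʳ : ∀ a {b} → b ≡ false → a ∧ b ≡ false
∧-falseʳ a refl = ∧-zeroʳ a

∨-true⁻ : ∀ a {b} → a ∨ b ≡ true → a ≡ true ⊎ b ≡ true
∨-true⁻ true  _ = inj₁ refl
∨-true⁻ false e = inj₂ e

∧-false⁻ : ∀ a {b} → a ∧ b ≡ false → a ≡ false ⊎ b ≡ false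
∧-false⁻ false _ = inj₁ refl
∧-false⁻ true  e = inj₂ e

not-true⁻ : ∀ {a} → not a ≡ true → a ≡ false
not-true⁻ {false} _ = refl

not-false⁻ : ∀ {a} → not a ≡ false → a ≡ true
not-false⁻ {true} _ = refl

⟦_⟧ : Form → (ℕ → Bool) → Bool
⟦ var p ⟧ f = f p
⟦ ⊥f ⟧ f = false
⟦ ¬f φ ⟧ f = not (⟦ φ ⟧ f)
⟦ φ ∧f ψ ⟧ f = ⟦ φ ⟧ f ∧ ⟦ ψ ⟧ f
⟦ φ ∨f ψ ⟧ f = ⟦ φ ⟧ f ∨ ⟦ ψ ⟧ f
⟦ NE ⟧ f = true

Forces : Bool → Form → Form → Set
Forces b r φ = ∀ f → ⟦ r ⟧ f ≡ true → ⟦ φ ⟧ f ≡ b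

mutual
  demands⁺ : Form → List Form
  demands⁺ (var p) = []
  demands⁺ ⊥f = []
  demands⁺ (¬f φ) = demands⁻ φ
  demands⁺ (φ ∧f ψ) = map (_∧f ψ) (demands⁺ φ) ++ map (φ ∧f_) (demands⁺ ψ)
  demands⁺ (φ ∨f ψ) = demands⁺ φ ++ demands⁺ ψ
  demands⁺ NE = ⊤f ∷ []

  demands⁻ : Form → List Form
  demands⁻ (var p) = []
  demands⁻ ⊥f = []
  demands⁻ (¬f φ) = demands⁺ φ
  demands⁻ (φ ∧f ψ) = demands⁻ φ ++ demands⁻ ψ
  demands⁻ (φ ∨f ψ) = map (_∧f (¬f ψ)) (demands⁻ φ) ++ map ((¬f φ) ∧f_) (demands⁻ ψ)
  demands⁻ NE = []

mutual
  demands⁺-force : ∀ φ → All (λ r → Forces true r φ) (demands⁺ φ)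
  demands⁺-force (var p) = []
  demands⁺-force ⊥f = []
  demands⁺-force (¬f φ) = All.map (λ force f → cong not ∘ force f) (demands⁻-force φ)
  demands⁺-force (φ ∧f ψ) =
    ++⁺ (gmap⁺ (λ force f e → cong₂ _∧_ (force f (∧-conicalˡ _ _ e)) (∧-conicalʳ _ _ e))
               (demands⁺-force φ))
        (gmap⁺ (λ force f e → cong₂ _∧_ (∧-conicalˡ _ _ e) (force f (∧-conicalʳ _ _ e)))
               (demands⁺-force ψ))
  demands⁺-force (φ ∨f ψ) =
    ++⁺ (All.map (λ force f e → cong (_∨ ⟦ ψ ⟧ f) (force f e)) (demands⁺-force φ))
        (All.map (λ force f e → ∨-trueʳ (⟦ φ ⟧ f) (force f e)) (demands⁺-force ψ))
  demands⁺-force NE = (λ _ _ → refl) ∷ []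

  demands⁻-force : ∀ φ → All (λ r → Forces false r φ) (demands⁻ φ)
  demands⁻-force (var p) = []
  demands⁻-force ⊥f = []
  demands⁻-force (¬f φ) = All.map (λ force f → cong not ∘ force f) (demands⁺-force φ)
  demands⁻-force (φ ∧f ψ) =
    ++⁺ (All.map (λ force f e → cong (_∧ ⟦ ψ ⟧ f) (force f e)) (demands⁻-force φ))
        (All.map (λ force f e → ∧-falseʳ (⟦ φ ⟧ f) (force f e)) (demands⁻-force ψ))
  demands⁻-force (φ ∨f ψ) =
    ++⁺ (gmap⁺ (λ force f e → cong₂ _∨_ (force f (∧-conicalˡ _ _ e)) (not-true⁻ (∧-conicalʳ _ _ e)))
               (demands⁻-force φ))
        (gmap⁺ (λ force f e → cong₂ _∨_ (not-true⁻ (∧-conicalˡ _ _ e)) (force f (∧-conicalʳ _ _ e)))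
               (demands⁻-force ψ))
  demands⁻-force NE = []

vars-⊆-weaken : ∀ {ys zs rs} → ys ⊆ zs → All (λ r → vars r ⊆ ys) rs → All (λ r → vars r ⊆ zs) rs
vars-⊆-weaken {ys} {zs} ys⊆zs =
  All.map {P = λ r → vars r ⊆ ys} {Q = λ r → vars r ⊆ zs} (λ r⊆ys → ⊆-trans r⊆ys ys⊆zs)

mutual
  demands⁺-vars : ∀ φ → All (λ r → vars r ⊆ vars φ) (demands⁺ φ)
  demands⁺-vars (var p) = []
  demands⁺-vars ⊥f = []
  demands⁺-vars (¬f φ) = demands⁻-vars φ
  demands⁺-vars (φ ∧f ψ) =
    ++⁺ (gmap⁺ (⊆.++⁺ˡ (vars ψ)) (demands⁺-vars φ)) (gmap⁺ (⊆.++⁺ʳ (vars φ)) (demands⁺-vars ψ))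
  demands⁺-vars (φ ∨f ψ) =
    ++⁺ (vars-⊆-weaken (xs⊆xs++ys (vars φ) (vars ψ)) (demands⁺-vars φ))
        (vars-⊆-weaken (xs⊆ys++xs (vars ψ) (vars φ)) (demands⁺-vars ψ))
  demands⁺-vars NE = (λ ()) ∷ []

  demands⁻-vars : ∀ φ → All (λ r → vars r ⊆ vars φ) (demands⁻ φ)
  demands⁻-vars (var p) = []
  demands⁻-vars ⊥f = []
  demands⁻-vars (¬f φ) = demands⁺-vars φ
  demands⁻-vars (φ ∧f ψ) =
    ++⁺ (vars-⊆-weaken (xs⊆xs++ys (vars φ) (vars ψ)) (demands⁻-vars φ))
        (vars-⊆-weaken (xs⊆ys++xs (vars ψ) (vars φ)) (demands⁻-vars ψ))
  demands⁻-vars (φ ∨f ψ) =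
    ++⁺ (gmap⁺ (⊆.++⁺ˡ (vars ψ)) (demands⁻-vars φ)) (gmap⁺ (⊆.++⁺ʳ (vars φ)) (demands⁻-vars ψ))
  demands⁻-vars NE = []

Satisfiable : List ℕ → Form → Set
Satisfiable X r = ∃[ w ] ⟦ r ⟧ (val X w) ≡ true

module _ (X : List ℕ) where

  models : Form → Team X
  models φ w = ⟦ φ ⟧ (val X w)

  _∩_ : Team X → Team X → Team X
  (s ∩ t) w = s w ∧ t w

  _⊆ₜ_ : Team X → Team X → Set
  t ⊆ₜ s = ∀ w → t w ≡ true → s w ≡ true

  Flat : Team X → Form → Bool → Set
  Flat s φ b = ∀ w → s w ≡ true → ⟦ φ ⟧ (val X w) ≡ b

  data Meets (s : Team X) (r : Form) : Set where
    meets : ∀ w → s w ≡ true → ⟦ r ⟧ (val X w) ≡ true → Meets s r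

  Char⁺ : Team X → Form → Set
  Char⁺ s φ = Flat s φ true × All (Meets s) (demands⁺ φ)

  Char⁻ : Team X → Form → Set
  Char⁻ s φ = Flat s φ false × All (Meets s) (demands⁻ φ)

  ∪-cases : ∀ {s} t u → IsUnion X s t u → ∀ {w} → s w ≡ true → t w ≡ true ⊎ u w ≡ true
  ∪-cases t u s≡t∪u {w} w∈s = ∨-true⁻ (t w) (trans (sym (s≡t∪u w)) w∈s)

  ∪-⊇ˡ : ∀ {s} t u → IsUnion X s t u → t ⊆ₜ s
  ∪-⊇ˡ t u s≡t∪u w w∈t = trans (s≡t∪u w) (cong (_∨ u w) w∈t)

  ∪-⊇ʳ : ∀ {s} t u → IsUnion X s t u → u ⊆ₜ s
  ∪-⊇ʳ t u s≡t∪u w w∈u = trans (s≡t∪u w) (∨-trueʳ (t w) w∈u)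

  ∩-cover : ∀ {s a b} → (∀ w → s w ≡ true → a w ≡ true ⊎ b w ≡ true) → IsUnion X s (s ∩ a) (s ∩ b)
  ∩-cover {s} {a} {b} cover w with s w in w∈s
  ... | false = refl
  ... | true = sym ([ cong (_∨ b w) , ∨-trueʳ (a w) ]′ (cover w w∈s))

  flat-¬ : ∀ {s b} φ → Flat s φ b → Flat s (¬f φ) (not b)
  flat-¬ _ flat w = cong not ∘ flat w

  flat-empty : ∀ {s b} φ → (∀ f → ⟦ φ ⟧ f ≡ not b) → Flat s φ b → Empty X s
  flat-empty φ ⟦φ⟧≡¬b flat w = ¬-not λ w∈s → not-¬ (flat w w∈s) (⟦φ⟧≡¬b (val X w))

  meets-mono : ∀ {s t r} → t ⊆ₜ s → Meets t r → Meets s r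
  meets-mono t⊆s (meets w w∈t r-true) = meets w (t⊆s w w∈t) r-true

  meets-∩ : ∀ {s t r} → (∀ w → ⟦ r ⟧ (val X w) ≡ true → t w ≡ true) → Meets s r → Meets (s ∩ t) r
  meets-∩ r⇒t (meets w w∈s r-true) = meets w (cong₂ _∧_ w∈s (r⇒t w r-true)) r-true

  meets-∧ˡ : ∀ {s r} ψ → Flat s ψ true → Meets s r → Meets s (r ∧f ψ)
  meets-∧ˡ _ flat (meets w w∈s r-true) = meets w w∈s (cong₂ _∧_ r-true (flat w w∈s))

  meets-∧ʳ : ∀ {s r} φ → Flat s φ true → Meets s r → Meets s (φ ∧f r)
  meets-∧ʳ _ flat (meets w w∈s r-true) = meets w w∈s (cong₂ _∧_ (flat w w∈s) r-true)

  meets-∧⁻ˡ : ∀ {s r ψ} → Meets s (r ∧f ψ) → Meets s r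
  meets-∧⁻ˡ (meets w w∈s r∧ψ-true) = meets w w∈s (∧-conicalˡ _ _ r∧ψ-true)

  meets-∧⁻ʳ : ∀ {s r φ} → Meets s (φ ∧f r) → Meets s r
  meets-∧⁻ʳ (meets w w∈s φ∧r-true) = meets w w∈s (∧-conicalʳ _ _ φ∧r-true)

  meets⇒satisfiable : ∀ {s r} → Meets s r → Satisfiable X r
  meets⇒satisfiable (meets w _ r-true) = w , r-true

  satisfiable⇒meets-models : ∀ φ {r} → Forces true r φ → Satisfiable X r → Meets (models φ) r
  satisfiable⇒meets-models φ force (w , r-true) = meets w (force (val X w) r-true) r-true

  -- Each demand of φ forces φ, so its witness in s survives the restriction to the models of φ.
  Char⁺-restrict : ∀ φ {s} → All (Meets s) (demands⁺ φ) → Char⁺ (s ∩ models φ) φ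
  Char⁺-restrict φ {s} ms =
    (λ w → ∧-conicalʳ (s w) _) ,
    All.zipWith (λ (m , force) → meets-∩ (force ∘ val X) m) (ms , demands⁺-force φ)

  Char⁻-restrict : ∀ φ {s} → All (Meets s) (demands⁻ φ) → Char⁻ (s ∩ models (¬f φ)) φ
  Char⁻-restrict φ {s} ms =
    (λ w → not-true⁻ ∘ ∧-conicalʳ (s w) _) ,
    All.zipWith (λ (m , force) → meets-∩ (λ w → cong not ∘ force (val X w)) m)
                (ms , demands⁻-force φ)

  mutual
    ⊨⇒Char⁺ : ∀ φ s → s ⊨[ X ] φ → Char⁺ s φ
    ⊨⇒Char⁺ (var p) s flat = flat , []
    ⊨⇒Char⁺ ⊥f s empty = (λ w w∈s → trans (sym (empty w)) w∈s) , []
    ⊨⇒Char⁺ (¬f φ) s s⊨⁻φ = map₁ (flat-¬ φ) (⊨⁻⇒Char⁻ φ s s⊨⁻φ)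
    ⊨⇒Char⁺ (φ ∧f ψ) s (s⊨φ , s⊨ψ) with ⊨⇒Char⁺ φ s s⊨φ | ⊨⇒Char⁺ ψ s s⊨ψ
    ... | flatφ , mφ | flatψ , mψ =
      (λ w w∈s → cong₂ _∧_ (flatφ w w∈s) (flatψ w w∈s)) ,
      ++⁺ (gmap⁺ (meets-∧ˡ ψ flatψ) mφ) (gmap⁺ (meets-∧ʳ φ flatφ) mψ)
    ⊨⇒Char⁺ (φ ∨f ψ) s (t , u , s≡t∪u , t⊨φ , u⊨ψ) with ⊨⇒Char⁺ φ t t⊨φ | ⊨⇒Char⁺ ψ u u⊨ψ
    ... | flatφ , mφ | flatψ , mψ =
      (λ w w∈s → [ cong (_∨ _) ∘ flatφ w , ∨-trueʳ _ ∘ flatψ w ]′ (∪-cases t u s≡t∪u w∈s)) ,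
      ++⁺ (All.map (meets-mono (∪-⊇ˡ t u s≡t∪u)) mφ) (All.map (meets-mono (∪-⊇ʳ t u s≡t∪u)) mψ)
    ⊨⇒Char⁺ NE s (w , w∈s) = (λ _ _ → refl) , meets w w∈s refl ∷ []

    ⊨⁻⇒Char⁻ : ∀ φ s → s ⊨⁻[ X ] φ → Char⁻ s φ
    ⊨⁻⇒Char⁻ (var p) s flat = flat , []
    ⊨⁻⇒Char⁻ ⊥f s _ = (λ _ _ → refl) , []
    ⊨⁻⇒Char⁻ (¬f φ) s s⊨φ = map₁ (flat-¬ φ) (⊨⇒Char⁺ φ s s⊨φ)
    ⊨⁻⇒Char⁻ (φ ∧f ψ) s (t , u , s≡t∪u , t⊨⁻φ , u⊨⁻ψ) with ⊨⁻⇒Char⁻ φ t t⊨⁻φ | ⊨⁻⇒Char⁻ ψ u u⊨⁻ψ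
    ... | flatφ , mφ | flatψ , mψ =
      (λ w w∈s → [ cong (_∧ _) ∘ flatφ w , ∧-falseʳ _ ∘ flatψ w ]′ (∪-cases t u s≡t∪u w∈s)) ,
      ++⁺ (All.map (meets-mono (∪-⊇ˡ t u s≡t∪u)) mφ) (All.map (meets-mono (∪-⊇ʳ t u s≡t∪u)) mψ)
    ⊨⁻⇒Char⁻ (φ ∨f ψ) s (s⊨⁻φ , s⊨⁻ψ) with ⊨⁻⇒Char⁻ φ s s⊨⁻φ | ⊨⁻⇒Char⁻ ψ s s⊨⁻ψ
    ... | flatφ , mφ | flatψ , mψ =
      (λ w w∈s → cong₂ _∨_ (flatφ w w∈s) (flatψ w w∈s)) ,
      ++⁺ (gmap⁺ (meets-∧ˡ (¬f ψ) (flat-¬ ψ flatψ)) mφ)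
          (gmap⁺ (meets-∧ʳ (¬f φ) (flat-¬ φ flatφ)) mψ)
    ⊨⁻⇒Char⁻ NE s empty = (λ w w∈s → trans (sym w∈s) (empty w)) , []

  mutual
    Char⁺⇒⊨ : ∀ φ s → Char⁺ s φ → s ⊨[ X ] φ
    Char⁺⇒⊨ (var p) s (flat , _) = flat
    Char⁺⇒⊨ ⊥f s (flat , _) = flat-empty ⊥f (λ _ → refl) flat
    Char⁺⇒⊨ (¬f φ) s (flat , ms) = Char⁻⇒⊨⁻ φ s ((λ w → not-true⁻ ∘ flat w) , ms)
    Char⁺⇒⊨ (φ ∧f ψ) s (flat , ms) with ++⁻ (map (_∧f ψ) (demands⁺ φ)) ms
    ... | mφ , mψ =
      Char⁺⇒⊨ φ s ((λ w → ∧-conicalˡ _ _ ∘ flat w) , gmap⁻ meets-∧⁻ˡ mφ) ,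
      Char⁺⇒⊨ ψ s ((λ w → ∧-conicalʳ _ _ ∘ flat w) , gmap⁻ meets-∧⁻ʳ mψ)
    Char⁺⇒⊨ (φ ∨f ψ) s (flat , ms) with ++⁻ (demands⁺ φ) ms
    ... | mφ , mψ =
      s ∩ models φ , s ∩ models ψ , ∩-cover (λ w → ∨-true⁻ _ ∘ flat w) ,
      Char⁺⇒⊨ φ _ (Char⁺-restrict φ mφ) , Char⁺⇒⊨ ψ _ (Char⁺-restrict ψ mψ)
    Char⁺⇒⊨ NE s (_ , meets w w∈s _ ∷ []) = w , w∈s

    Char⁻⇒⊨⁻ : ∀ φ s → Char⁻ s φ → s ⊨⁻[ X ] φ
    Char⁻⇒⊨⁻ (var p) s (flat , _) = flat
    Char⁻⇒⊨⁻ ⊥f s _ = tt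
    Char⁻⇒⊨⁻ (¬f φ) s (flat , ms) = Char⁺⇒⊨ φ s ((λ w → not-false⁻ ∘ flat w) , ms)
    Char⁻⇒⊨⁻ (φ ∧f ψ) s (flat , ms) with ++⁻ (demands⁻ φ) ms
    ... | mφ , mψ =
      s ∩ models (¬f φ) , s ∩ models (¬f ψ) ,
      ∩-cover (λ w → Sum.map (cong not) (cong not) ∘ ∧-false⁻ _ ∘ flat w) ,
      Char⁻⇒⊨⁻ φ _ (Char⁻-restrict φ mφ) , Char⁻⇒⊨⁻ ψ _ (Char⁻-restrict ψ mψ)
    Char⁻⇒⊨⁻ (φ ∨f ψ) s (flat , ms) with ++⁻ (map (_∧f (¬f ψ)) (demands⁻ φ)) ms
    ... | mφ , mψ =
      Char⁻⇒⊨⁻ φ s ((λ w → ∨-conicalˡ _ _ ∘ flat w) , gmap⁻ meets-∧⁻ˡ mφ) ,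
      Char⁻⇒⊨⁻ ψ s ((λ w → ∨-conicalʳ _ _ ∘ flat w) , gmap⁻ meets-∧⁻ʳ mψ)
    Char⁻⇒⊨⁻ NE s (flat , _) = flat-empty NE (λ _ → refl) flat

-- A valuation over X, a Vec Bool (length X), is also a Subset (length X).
satisfiable? : ∀ X r → Dec (Satisfiable X r)
satisfiable? X r = anySubset? (λ w → ⟦ r ⟧ (val X w) ≟ᵇ true)

valuation : (Y : List ℕ) → (ℕ → Bool) → Val Y
valuation [] f = []
valuation (y ∷ Y) f = f y ∷ valuation Y f

val-valuation : ∀ Y f {p} → p ∈ Y → val Y (valuation Y f) p ≡ f p
val-valuation (y ∷ Y) f {p} p∈Y with y ≡ᵇ p in y≡ᵇp | p∈Y
... | true  | _ = cong f (≡ᵇ⇒≡ y p (from T-≡ y≡ᵇp))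
... | false | here refl = contradiction y≡ᵇp (not-¬ (to T-≡ (≡⇒≡ᵇ p p refl)))
... | false | there p∈ = val-valuation Y f p∈

⟦⟧-coincidence : ∀ r {f g} → (∀ {p} → p ∈ vars r → f p ≡ g p) → ⟦ r ⟧ f ≡ ⟦ r ⟧ g
⟦⟧-coincidence (var p) f≗g = f≗g (here refl)
⟦⟧-coincidence ⊥f f≗g = refl
⟦⟧-coincidence (¬f r) f≗g = cong not (⟦⟧-coincidence r f≗g)
⟦⟧-coincidence (r ∧f r′) f≗g =
  cong₂ _∧_ (⟦⟧-coincidence r (f≗g ∘ ∈-++⁺ˡ)) (⟦⟧-coincidence r′ (f≗g ∘ ∈-++⁺ʳ (vars r)))
⟦⟧-coincidence (r ∨f r′) f≗g =
  cong₂ _∨_ (⟦⟧-coincidence r (f≗g ∘ ∈-++⁺ˡ)) (⟦⟧-coincidence r′ (f≗g ∘ ∈-++⁺ʳ (vars r)))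
⟦⟧-coincidence NE f≗g = refl

satisfiable-transfer : ∀ X {Y} r → vars r ⊆ Y → Satisfiable X r → Satisfiable Y r
satisfiable-transfer X {Y} r r⊆Y (w , r-true) =
  valuation Y (val X w) , trans (⟦⟧-coincidence r (val-valuation Y (val X w) ∘ r⊆Y)) r-true

All-satisfiable-transfer : ∀ {X Y rs} → All (λ r → vars r ⊆ Y) rs →
                           All (Satisfiable X) rs → All (Satisfiable Y) rs
All-satisfiable-transfer [] [] = []
All-satisfiable-transfer {X} {rs = r ∷ _} (r⊆Y ∷ rs⊆Y) (sat ∷ sats) =
  satisfiable-transfer X r r⊆Y sat ∷ All-satisfiable-transfer {X} rs⊆Y sats

supported⇒demands-satisfiable : ∀ φ {X} (s : Team X) → s ⊨[ X ] φ →
                                All (Satisfiable (vars φ)) (demands⁺ φ)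
supported⇒demands-satisfiable φ {X} s s⊨φ =
  All-satisfiable-transfer {X} (demands⁺-vars φ)
    (All.map (meets⇒satisfiable X) (proj₂ (⊨⇒Char⁺ X φ s s⊨φ)))

models-supported : ∀ X φ → All (Satisfiable X) (demands⁺ φ) → models X φ ⊨[ X ] φ
models-supported X φ sats =
  Char⁺⇒⊨ X φ (models X φ)
    ((λ _ → id) ,
     All.zipWith (λ (force , sat) → satisfiable⇒meets-models X φ force sat) (demands⁺-force φ , sats))

ground⇔model : ∀ {X} φ → All (Satisfiable (vars φ)) (demands⁺ φ) → vars φ ⊆ X →
               ∀ w → Ground X φ w ⇔ models X φ w ≡ true
ground⇔model {X} φ sats φ⊆X w = mk⇔
  (λ (s , s⊨φ , w∈s) → proj₁ (⊨⇒Char⁺ X φ s s⊨φ) w w∈s)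
  (λ w⊨φ → models X φ , models-supported X φ sats′ , w⊨φ)
  where
  sats′ : All (Satisfiable X) (demands⁺ φ)
  sats′ = All-satisfiable-transfer {vars φ} (vars-⊆-weaken φ⊆X (demands⁺-vars φ)) sats

unsupported⇒≡⊥∧NE : ∀ φ → (∀ X (s : Team X) → ¬ s ⊨[ X ] φ) → φ ≡f (⊥f ∧f NE)
unsupported⇒≡⊥∧NE φ unsupported X _ _ s =
  mk⇔ (⊥-elim ∘ unsupported X s) (λ (empty , w , w∈s) → contradiction (empty w) (not-¬ w∈s))

exactly-one : ∀ {A B C : Set} → A → ¬ B → C → (A ⇔ (C × ¬ B)) × (B ⇔ (C × ¬ A))
exactly-one a ¬b c =
  mk⇔ (λ _ → c , ¬b) (λ _ → a) , mk⇔ (⊥-elim ∘ ¬b) (λ (_ , ¬a) → contradiction a ¬a)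

complement-by-bool : ∀ {A B C : Set} b → C → A ⇔ (b ≡ true) → B ⇔ (not b ≡ true) →
                     (A ⇔ (C × ¬ B)) × (B ⇔ (C × ¬ A))
complement-by-bool true  c A⇔ B⇔ =
  exactly-one (from A⇔ refl) (λ b → contradiction (to B⇔ b) λ ()) c
complement-by-bool false c A⇔ B⇔ =
  swap (exactly-one (from B⇔ refl) (λ a → contradiction (to A⇔ a) λ ()) c)

ground-⊤ : ∀ X w → Ground X ⊤f w
ground-⊤ X w = (λ _ → true) , tt , refl

ground-complementary : ∀ {X} φ ψ (g : Val X → Bool) →
                       (∀ w → Ground X φ w ⇔ g w ≡ true) → (∀ w → Ground X ψ w ⇔ not (g w) ≡ true) →
                       GroundDiff X φ ψ × GroundDiff X ψ φ
ground-complementary {X} _ _ g φ⇔ ψ⇔ =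
  (λ w → proj₁ (complement-by-bool (g w) (ground-⊤ X w) (φ⇔ w) (ψ⇔ w))) ,
  (λ w → proj₂ (complement-by-bool (g w) (ground-⊤ X w) (φ⇔ w) (ψ⇔ w)))

proposition3p19 : (φ : Form) →
    ((X : List ℕ) → Over X φ → GroundDiff X φ (¬f φ) × GroundDiff X (¬f φ) φ)
    ⊎ (φ ≡f (⊥f ∧f NE))
    ⊎ ((¬f φ) ≡f (⊥f ∧f NE))
proposition3p19 φ
  with all? (satisfiable? (vars φ)) (demands⁺ φ) | all? (satisfiable? (vars φ)) (demands⁻ φ)
... | no ¬sats | _ =
  inj₂ (inj₁ (unsupported⇒≡⊥∧NE φ λ X s → ¬sats ∘ supported⇒demands-satisfiable φ s))
... | yes _ | no ¬sats =
  inj₂ (inj₂ (unsupported⇒≡⊥∧NE (¬f φ) λ X s → ¬sats ∘ supported⇒demands-satisfiable (¬f φ) s))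
... | yes sats⁺ | yes sats⁻ = inj₁ λ X (_ , φ⊆X) →
  ground-complementary φ (¬f φ) (models X φ)
    (ground⇔model φ sats⁺ (All.lookup φ⊆X)) (ground⇔model (¬f φ) sats⁻ (All.lookup φ⊆X))
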